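{- Let $\Gamma=(V,E)$ be a vertex-transitive graph admitting an extended irregular dominating set $S$ (with its labeling). Then for every vertex $u\in V$ there exists a unique vertex $v\in S$ covering $u$.
   Context: Let $\Gamma=(V,E)$ be an undirected simple graph with graph distance $d$. A vertex $v$ carrying a positive integer label $\ell$ dominates (covers) exactly the vertices $u$ with $d(u,v)=\ell$; a vertex carrying label $0$ covers only itself. An extended irregular dominating set is a set $S\subseteq V$ together with an injective labeling $\lambda:S\to\{0,1,2,\dots\}$ such that every vertex of $V$ is covered by at least one vertex of $S$, where some vertex of $S$ has label $0$. -}

module Defs where

open import Data.Nat using (ℕ; zero; suc; _<_)
open import Data.Fin using (Fin)
open import Data.Fin.Subset using (Subset; _∈_)
open import Data.Fin.Permutation using (Permutation′; _⟨$⟩ʳ_)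
open import Data.Product using (Σ; ∃; _×_)
open import Data.Empty using (⊥)
open import Relation.Nullary using (¬_)
open import Relation.Binary.PropositionalEquality using (_≡_)

record Graph (n : ℕ) : Set₁ where
  field
    Adj     : Fin n → Fin n → Set
    sym     : ∀ {u v} → Adj u v → Adj v u
    irrefl  : ∀ {u} → ¬ Adj u u
open Graph public

data Walk {n : ℕ} (G : Graph n) : Fin n → Fin n → ℕ → Set where
  here : ∀ {u} → Walk G u u zero
  step : ∀ {u w v k} → Adj G u w → Walk G w v k → Walk G u v (suc k)

Dist : ∀ {n} → Graph n → Fin n → Fin n → ℕ → Set
Dist G u v ℓ = Walk G u v ℓ × (∀ k → k < ℓ → ¬ Walk G u v k)

-- A vertex v with label ℓ covers u iff d(u,v) = ℓ
-- (for ℓ = 0 this says exactly u ≡ v, i.e. v covers only itself).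
Covers : ∀ {n} → Graph n → Fin n → ℕ → Fin n → Set
Covers G v ℓ u = Dist G u v ℓ

IsAutomorphism : ∀ {n} → Graph n → Permutation′ n → Set
IsAutomorphism G σ =
  ∀ u w → (Adj G u w → Adj G (σ ⟨$⟩ʳ u) (σ ⟨$⟩ʳ w))
        × (Adj G (σ ⟨$⟩ʳ u) (σ ⟨$⟩ʳ w) → Adj G u w)

VertexTransitive : ∀ {n} → Graph n → Set
VertexTransitive {n} G =
  ∀ u v → Σ (Permutation′ n) λ σ → IsAutomorphism G σ × (σ ⟨$⟩ʳ u ≡ v)

-- Extended irregular dominating set: S ⊆ V with labeling λ injective on S,
-- every vertex covered by some vertex of S, and some vertex of S labelled 0.
-- (λ is given as a total function; only its values on S matter.)
IsExtIrrDomSet : ∀ {n} → Graph n → Subset n → (Fin n → ℕ) → Set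
IsExtIrrDomSet {n} G S lab =
    (∀ {v w} → v ∈ S → w ∈ S → lab v ≡ lab w → v ≡ w)
  × (∀ u → ∃ λ v → v ∈ S × Covers G v (lab v) u)
  × (∃ λ v → v ∈ S × lab v ≡ 0)

-- Fix a vertex h and, for every vertex v, an automorphism σᵥ with σᵥ v = h.
-- If v ∈ S covers a then σᵥ a lies at distance λ v from h; distances are
-- unique and λ is injective on S, so σᵥ a determines v, and then a.  Hence the
-- covering pairs (v , a) embed into V.  Choosing one coverer per vertex gives
-- |V| covering pairs already, so a second coverer of some vertex would give
-- |V| + 1 of them, which the pigeonhole principle forbids.
module Submission where

open import Defs hiding (sym)
open import Data.Nat using (ℕ; suc)
open import Data.Nat.Properties using (<-cmp; n<1+n)
open import Data.Fin using (Fin; zero; suc; _<_)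
open import Data.Fin.Subset using (Subset; _∈_)
open import Data.Fin.Properties using (pigeonhole; <-irrefl)
open import Data.Fin.Permutation using (Permutation′; _⟨$⟩ʳ_; flip; inverseˡ; inverseʳ)
open import Data.Product using (_×_; ∃!; Σ; _,_; proj₁; proj₂)
open import Data.Empty using (⊥-elim)
open import Function.Bundles using (Injection)
open import Function.Properties.Inverse using (↔⇒↣)
open import Relation.Binary.Definitions using (tri<; tri≈; tri>)
open import Relation.Binary.PropositionalEquality using (_≡_; refl; sym; subst; subst₂)

module _ {A : Set} {n : ℕ} (R : A → Fin n → Set) (code : A → Fin n → Fin n)
         (code-injective : ∀ {v a w b} → R v a → R w b →
                           code v a ≡ code w b → v ≡ w × a ≡ b)
         (choose : ∀ a → Σ A λ v → R v a) where

  private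
    chosen : Fin n → A
    chosen a = proj₁ (choose a)

    codes : A → Fin n → Fin (suc n) → Fin n
    codes v a zero    = code v a
    codes v a (suc b) = code (chosen b) b

    collision⇒chosen : ∀ {v a} → R v a → ∀ {i j} → i < j →
                       codes v a i ≡ codes v a j → chosen a ≡ v
    collision⇒chosen Rva {zero} {suc b} _ eq with code-injective Rva (proj₂ (choose b)) eq
    ... | v≡chosen , refl = sym v≡chosen
    collision⇒chosen Rva {suc i} {suc j} i<j eq
      with code-injective (proj₂ (choose i)) (proj₂ (choose j)) eq
    ... | _ , refl = ⊥-elim (<-irrefl refl i<j)

  chosen-unique : ∀ {a v} → R v a → chosen a ≡ v
  chosen-unique {a} {v} Rva with i , j , i<j , eq ← pigeonhole (n<1+n n) (codes v a) =
    collision⇒chosen Rva i<j eq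

module _ {n : ℕ} {G : Graph n} where

  walk-map : (σ : Permutation′ n) → IsAutomorphism G σ →
             ∀ {u v k} → Walk G u v k → Walk G (σ ⟨$⟩ʳ u) (σ ⟨$⟩ʳ v) k
  walk-map σ aut here = here
  walk-map σ aut (step {u} {w} adj walk) = step (proj₁ (aut u w) adj) (walk-map σ aut walk)

  flip-automorphism : (σ : Permutation′ n) → IsAutomorphism G σ → IsAutomorphism G (flip σ)
  flip-automorphism σ aut _ _ =
    (λ adj → proj₂ (aut _ _) (subst₂ (Adj G) (sym (inverseʳ σ)) (sym (inverseʳ σ)) adj)) ,
    (λ adj → subst₂ (Adj G) (inverseʳ σ) (inverseʳ σ) (proj₁ (aut _ _) adj))

  walk-reflect : (σ : Permutation′ n) → IsAutomorphism G σ →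
                 ∀ {u v k} → Walk G (σ ⟨$⟩ʳ u) (σ ⟨$⟩ʳ v) k → Walk G u v k
  walk-reflect σ aut walk =
    subst₂ (λ x y → Walk G x y _) (inverseˡ σ) (inverseˡ σ)
      (walk-map (flip σ) (flip-automorphism σ aut) walk)

  dist-map : (σ : Permutation′ n) → IsAutomorphism G σ →
             ∀ {u v ℓ} → Dist G u v ℓ → Dist G (σ ⟨$⟩ʳ u) (σ ⟨$⟩ʳ v) ℓ
  dist-map σ aut (walk , minimal) =
    walk-map σ aut walk , λ k k<ℓ shorter → minimal k k<ℓ (walk-reflect σ aut shorter)

  dist-functional : ∀ {u v ℓ ℓ′} → Dist G u v ℓ → Dist G u v ℓ′ → ℓ ≡ ℓ′
  dist-functional {ℓ = ℓ} {ℓ′} (walk , minimal) (walk′ , minimal′) with <-cmp ℓ ℓ′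
  ... | tri< ℓ<ℓ′ _ _ = ⊥-elim (minimal′ ℓ ℓ<ℓ′ walk)
  ... | tri≈ _ ℓ≡ℓ′ _ = ℓ≡ℓ′
  ... | tri> _ _ ℓ′<ℓ = ⊥-elim (minimal ℓ′ ℓ′<ℓ walk′)

module HubCoding {n : ℕ} (G : Graph n) (transitive : VertexTransitive G) (hub : Fin n)
         (S : Subset n) (lab : Fin n → ℕ)
         (lab-injective : ∀ {v w} → v ∈ S → w ∈ S → lab v ≡ lab w → v ≡ w) where

  CoveringPair : Fin n → Fin n → Set
  CoveringPair v a = v ∈ S × Covers G v (lab v) a

  private
    toHub : Fin n → Permutation′ n
    toHub v = proj₁ (transitive v hub)

  hubCode : Fin n → Fin n → Fin n
  hubCode v a = toHub v ⟨$⟩ʳ a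

  hubCode-dist : ∀ {v a} → Covers G v (lab v) a → Dist G (hubCode v a) hub (lab v)
  hubCode-dist {v} cover with transitive v hub
  ... | σ , aut , refl = dist-map σ aut cover

  hubCode-injective : ∀ {v a w b} → CoveringPair v a → CoveringPair w b →
                      hubCode v a ≡ hubCode w b → v ≡ w × a ≡ b
  hubCode-injective {v} (v∈S , cover) (w∈S , cover′) same
    with refl ← lab-injective v∈S w∈S
                  (dist-functional (hubCode-dist cover)
                    (subst (λ x → Dist G x hub _) (sym same) (hubCode-dist cover′)))
    = refl , Injection.injective (↔⇒↣ (toHub v)) same

theorem2p5 : ∀ {n : ℕ} (G : Graph n) → VertexTransitive G →
    (S : Subset n) (lab : Fin n → ℕ) → IsExtIrrDomSet G S lab →
    ∀ (u : Fin n) → ∃! _≡_ (λ v → v ∈ S × Covers G v (lab v) u)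
-- The vertex labelled 0 plays no role in the argument.
theorem2p5 G transitive S lab (lab-injective , covered , _) u =
  proj₁ (covered u) , proj₂ (covered u) ,
  chosen-unique CoveringPair hubCode hubCode-injective covered
  where open HubCoding G transitive u S lab lab-injective
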